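{- For every level $\ell$ and every $\delta>0$, the number $q$ of epochs in $\mathcal{E}_\ell$ with duration at least $\delta$ satisfies $q\le 2|IN_\ell|/\delta$, where $IN_\ell$ is the set of insertions in the update sequence of edges incident to vertices at level $\ell$.
   Context: Setting: $G=(V,E)$ is a dynamic graph on a fixed set $V$ of $n$ vertices that starts with no edges and undergoes a sequence of updates, each the insertion or deletion of one edge. A fixed integer $\Delta>0$ upper-bounds the maximum degree of $G$ at all times, and $\mathcal{C}=\{1,\dots,\Delta+1\}$ is the set of colors. Let $L=\lceil\log_3(n-1)\rceil-1$. The algorithm maintains a coloring $\chi:V\to\mathcal{C}$ and a level $\ell(v)\in\{ -1,0,\dots,L\}$ for each vertex $v$. For an edge $uv$, $u$ is an up-neighbor of $v$ if $\ell(u)\ge\ell(v)$ and a down-neighbor of $v$ if $\ell(u)<\ell(v)$. For a level $k$, $\phi_v(k)$ is the number of neighbors $u$ of $v$ with $\ell(u)<k$. A color $c$ is blank for $v$ if no neighbor of $v$ has color $c$, and unique for $v$ if no up-neighbor of $v$ has color $c$ and exactly one down-neighbor of $v$ has color $c$. Algorithm: initially every vertex is at level $-1$ with an arbitrary color. A deletion changes nothing. On insertion of an edge $uv$: if $\chi(u)\neq\chi(v)$ nothing changes; otherwise let $x$ be the endpoint among $u,v$ that was recolored most recently, and repeat $x\leftarrow\texttt{recolor}(x)$ until $x=\mathrm{NULL}$. The procedure $\texttt{recolor}(x)$: if $\phi_x(\ell(x)+1)<3^{\ell(x)+2}$, call $\texttt{det-color}(x)$, which assigns to $x$ a deterministically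 chosen blank color, sets $\ell(x)=-1$, and then return NULL. Otherwise call $\texttt{rand-color}(x)$, which: lets $\ell'$ be the minimum level $\ell'>\ell(x)$ with $\phi_x(\ell'+1)<3^{\ell'+2}$ and sets $\ell(x)=\ell'$; picks uniformly at random a color $c$ among the colors that are blank or unique for $x$ and sets $\chi(x)=c$; returns NULL if $c$ is blank for $x$, and otherwise returns the unique down-neighbor $y$ of $x$ with $\chi(y)=c$. Epochs: an epoch $\mathcal{E}$ of a vertex $v=v(\mathcal{E})$ is a maximal time interval during which $v$ keeps the same color; it starts with a call to $\texttt{recolor}(v)$ and ends immediately before the next call to $\texttt{recolor}(v)$, if any; $\ell(\mathcal{E})$ is the (constant) level of $v$ during $\mathcal{E}$, and $\mathcal{E}_\ell$ is the set of epochs at level $\ell$. A non-final epoch is original if the call $\texttt{recolor}(v)$ ending it is triggered by the insertion of an edge $uv$ with $\chi(u)=\chi(v)$. The duration $dur(\mathcal{E})$ is the number of insertions of edges incident to $v$ that happen during $\mathcal{E}$, plus the insertion that terminates $\mathcal{E}$ if $\mathcal{E}$ is original. -}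

module Defs where

open import Data.Nat using (ℕ; zero; suc; _+_; _*_; _^_; _≤_; _<_; _<ᵇ_; _≤ᵇ_; _≡ᵇ_)
open import Data.Bool using (Bool; true; false; _∧_; _∨_; if_then_else_; not)
open import Data.Fin using (Fin; _≟_)
import Data.Fin as F
open import Data.Maybe using (Maybe; just; nothing)
open import Data.Product using (Σ; _×_; _,_)
open import Data.Sum using (_⊎_)
open import Relation.Binary.PropositionalEquality using (_≡_; _≢_)
open import Relation.Nullary using (¬_)
open import Relation.Nullary.Decidable using (⌊_⌋)

-- Conventions
--  * vertices : Fin n ; colours {1,…,Δ+1} : Fin (suc Δ)
--  * LEVELS ARE SHIFTED BY ONE: the stored value s : ℕ represents the
--    paper's level ℓ = s - 1, so the paper's level -1 is stored as 0.
--  * the graph is a symmetric adjacency function Fin n → Fin n → Bool.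

eqᵇ : ∀ {n} → Fin n → Fin n → Bool
eqᵇ a b = ⌊ a ≟ b ⌋

cntV : ∀ {n} → (Fin n → Bool) → ℕ
cntV {zero}  p = 0
cntV {suc n} p = (if p F.zero then 1 else 0) + cntV (λ i → p (F.suc i))

cntT : ℕ → (ℕ → Bool) → ℕ
cntT zero    p = 0
cntT (suc m) p = cntT m p + (if p m then 1 else 0)

upd : ∀ {n} {A : Set} → (Fin n → A) → Fin n → A → Fin n → A
upd f x a y = if eqᵇ y x then a else f y

record State (n Δ : ℕ) : Set where
  field
    adj     : Fin n → Fin n → Bool
    col     : Fin n → Fin (suc Δ)
    lvl     : Fin n → ℕ                 -- shifted level (ℓ + 1)
    last    : Fin n → ℕ                 -- time stamp of last recolor (0 = never)
    clock   : ℕ                         -- number of recolor calls so far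
    pending : Maybe (Fin n)             -- vertex x still to be recoloured in the loop
open State public

module _ {n Δ : ℕ} (s : State n Δ) where

  deg : Fin n → ℕ
  deg x = cntV (adj s x)

  -- φ_x(k) for the paper's level k ≥ 0: neighbours u with ℓ(u) < k,
  -- i.e. with shifted level < k + 1
  phi : Fin n → ℕ → ℕ
  phi x k = cntV (λ u → adj s x u ∧ (lvl s u <ᵇ suc k))

  -- the test φ_x(ℓ+1) < 3^(ℓ+2), written for the shifted level t = ℓ+1
  Ok : Fin n → ℕ → Set
  Ok x t = phi x t < 3 ^ suc t

  UpNbr : Fin n → Fin n → Set
  UpNbr x u = adj s x u ≡ true × lvl s x ≤ lvl s u

  DownNbr : Fin n → Fin n → Set
  DownNbr x u = adj s x u ≡ true × lvl s u < lvl s x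

  Blank : Fin n → Fin (suc Δ) → Set
  Blank x c = ∀ u → adj s x u ≡ true → col s u ≢ c

  UniqueWith : Fin n → Fin (suc Δ) → Fin n → Set
  UniqueWith x c y =
    (∀ u → UpNbr x u → col s u ≢ c) ×
    (DownNbr x y × col s y ≡ c ×
     (∀ z → DownNbr x z → col s z ≡ c → z ≡ y))

  MinLevel : Fin n → ℕ → Set
  MinLevel x t = lvl s x < t × Ok x t × (∀ t' → lvl s x < t' → t' < t → ¬ Ok x t')

  -- x is the endpoint among u, v recoloured most recently
  -- (ties, possible only if neither was ever recoloured, broken arbitrarily)
  MostRecent : Fin n → Fin n → Fin n → Set
  MostRecent u v x = (x ≡ u × last s v ≤ last s u) ⊎ (x ≡ v × last s u ≤ last s v)

  addEdge : Fin n → Fin n → State n Δ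
  addEdge u v = record s { adj = λ a b → adj s a b ∨ ((eqᵇ a u ∧ eqᵇ b v) ∨ (eqᵇ a v ∧ eqᵇ b u)) }

  delEdge : Fin n → Fin n → State n Δ
  delEdge u v = record s { adj = λ a b → adj s a b ∧ not ((eqᵇ a u ∧ eqᵇ b v) ∨ (eqᵇ a v ∧ eqᵇ b u)) }

  setLvl : Fin n → ℕ → State n Δ
  setLvl x t = record s { lvl = upd (lvl s) x t }

  recolorTo : Fin n → Fin (suc Δ) → Maybe (Fin n) → State n Δ
  recolorTo x c p = record s { col = upd (col s) x c ; last = upd (last s) x (suc (clock s))
                             ; clock = suc (clock s) ; pending = p }

initState : ∀ {n Δ} → (Fin n → Fin (suc Δ)) → State n Δ
initState χ₀ = record { adj = λ _ _ → false ; col = χ₀ ; lvl = λ _ → 0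
                      ; last = λ _ → 0 ; clock = 0 ; pending = nothing }

data Label (n : ℕ) : Set where
  ins : Fin n → Fin n → Label n
  del : Fin n → Fin n → Label n
  rec : Fin n → Label n

-- One step of the algorithm. Random choices / the deterministic blank
-- choice are modelled nondeterministically (every possible outcome).
data Step {n Δ : ℕ} (s : State n Δ) : Label n → State n Δ → Set where
  insNoConflict : ∀ {u v} → pending s ≡ nothing → u ≢ v → adj s u v ≡ false →
    col s u ≢ col s v → Step s (ins u v) (addEdge s u v)
  insConflict : ∀ {u v x} → pending s ≡ nothing → u ≢ v → adj s u v ≡ false →
    col s u ≡ col s v → MostRecent s u v x →
    Step s (ins u v) (record (addEdge s u v) { pending = just x })
  delete : ∀ {u v} → pending s ≡ nothing → adj s u v ≡ true →
    Step s (del u v) (delEdge s u v)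
  -- det-color: blank colour, level -1 (stored 0), return NULL
  detColor : ∀ {x c} → pending s ≡ just x → Ok s x (lvl s x) → Blank s x c →
    Step s (rec x) (recolorTo (setLvl s x 0) x c nothing)
  -- rand-color, chosen colour blank: return NULL
  randBlank : ∀ {x t c} → pending s ≡ just x → ¬ Ok s x (lvl s x) → MinLevel s x t →
    Blank (setLvl s x t) x c →
    Step s (rec x) (recolorTo (setLvl s x t) x c nothing)
  -- rand-color, chosen colour unique (w.r.t. the new level): return y
  randUnique : ∀ {x t c y} → pending s ≡ just x → ¬ Ok s x (lvl s x) → MinLevel s x t →
    UniqueWith (setLvl s x t) x c y →
    Step s (rec x) (recolorTo (setLvl s x t) x c (just y))

record Run (n Δ m : ℕ) : Set where
  field
    χ₀     : Fin n → Fin (suc Δ)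
    st     : ℕ → State n Δ
    lab    : ℕ → Label n
    start  : st 0 ≡ initState χ₀
    steps  : ∀ i → i < m → Step (st i) (lab i) (st (suc i))
    done   : pending (st m) ≡ nothing
    degBnd : ∀ i → i ≤ m → ∀ x → deg (st i) x ≤ Δ
open Run public

module _ {n Δ m : ℕ} (R : Run n Δ m) where

  isRecOf : Fin n → Label n → Bool
  isRecOf v (rec x)   = eqᵇ x v
  isRecOf v (ins _ _) = false
  isRecOf v (del _ _) = false

  isInsOf : Fin n → Label n → Bool
  isInsOf v (ins a b) = eqᵇ a v ∨ eqᵇ b v
  isInsOf v (rec _)   = false
  isInsOf v (del _ _) = false

  noRecBetween : Fin n → ℕ → ℕ → Bool
  noRecBetween v i k = cntT k (λ t → (i <ᵇ t) ∧ isRecOf v (lab R t)) ≡ᵇ 0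

  -- duration of the epoch of v started by the recolor(v) call at time i:
  -- insertions of edges incident to v at times k after i and before the
  -- next recolor(v) call (this includes the terminating insertion when the
  -- epoch is original, counted once)
  dur : Fin n → ℕ → ℕ
  dur v i = cntT m (λ k → (i <ᵇ k) ∧ isInsOf v (lab R k) ∧ noRecBetween v i k)

  -- epochs at (shifted) level ℓ with duration ≥ δ; epochs are indexed by
  -- the time i of the recolor call starting them, level read after it
  epochOK : ℕ → ℕ → Label n → ℕ → Bool
  epochOK ℓ δ (rec x)   i = (lvl (st R (suc i)) x ≡ᵇ ℓ) ∧ (δ ≤ᵇ dur x i)
  epochOK ℓ δ (ins _ _) i = false
  epochOK ℓ δ (del _ _) i = false

  numLongEpochs : ℕ → ℕ → ℕ
  numLongEpochs ℓ δ = cntT m (λ i → epochOK ℓ δ (lab R i) i)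

  insAtLevel : ℕ → Label n → ℕ → Bool
  insAtLevel ℓ (ins a b) k = (lvl (st R k) a ≡ᵇ ℓ) ∨ (lvl (st R k) b ≡ᵇ ℓ)
  insAtLevel ℓ (rec _)   k = false
  insAtLevel ℓ (del _ _) k = false

  -- |IN_ℓ|: insertions of an edge with an endpoint at level ℓ at insertion time
  numIN : ℕ → ℕ
  numIN ℓ = cntT m (λ k → insAtLevel ℓ (lab R k) k)

module Submission where

-- Lemma 11 is a double-counting argument.  Call the pair (i , k) an
-- incidence when the call at time i is recolor(x), opening an epoch of x
-- at level ℓ, and the update at time k is an insertion incident to x that
-- counts towards the duration of that epoch.
--
--  * Row bound: an epoch of duration ≥ δ takes part in ≥ δ incidences, so
--    (number of long level-ℓ epochs) * δ ≤ (number of incidences).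
--  * Column bound: an insertion of uv at time k takes part in at most two
--    incidences, one per endpoint, because each vertex has at most one
--    running epoch at time k; and if an endpoint has a level-ℓ epoch
--    running at time k, that endpoint is at level ℓ at time k (levels only
--    change at recolor calls), so the insertion belongs to IN_ℓ.

open import Defs
open import Data.Nat using (ℕ; zero; suc; _+_; _*_; _≤_; _<_; _≡ᵇ_; _<ᵇ_; z≤n)
open import Data.Nat.Properties
  using ( +-identityʳ; *-identityʳ; *-zeroʳ; *-comm; *-distribˡ-+; +-commutativeSemigroup
        ; ≤-refl; ≤-trans; ≤-reflexive; +-mono-≤; m≤m+n; ≤-pred; <⇒≤; m<n⇒m<1+n
        ; m≤n⇒m<n∨m≡n; <-cmp; <-irrefl; m+n≡0⇒m≡0; m+n≡0⇒n≡0
        ; ≡ᵇ⇒≡; ≡⇒≡ᵇ; <ᵇ⇒<; <⇒<ᵇ; ≤ᵇ⇒≤; module ≤-Reasoning )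
open import Algebra.Properties.CommutativeSemigroup +-commutativeSemigroup using (interchange)
open import Data.Bool using (Bool; true; false; _∧_; _∨_; if_then_else_; T)
open import Data.Bool.Properties using (T-≡; ∧-zeroʳ)
open import Data.Fin using (Fin; _≟_)
open import Data.Product using (_×_; _,_)
open import Data.Sum using (inj₁; inj₂)
open import Function.Bundles using (Equivalence)
open import Relation.Binary using (tri<; tri≈; tri>)
open import Relation.Binary.PropositionalEquality
  using (_≡_; refl; sym; trans; cong; cong₂; subst)
open import Relation.Nullary using (yes; no; ¬_; contradiction)

T⇒≡true : ∀ {b} → T b → b ≡ true
T⇒≡true = Equivalence.to T-≡

≡true⇒T : ∀ {b} → b ≡ true → T b
≡true⇒T = Equivalence.from T-≡

∧-swap : ∀ a b c → a ∧ (b ∧ c) ≡ b ∧ (a ∧ c)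
∧-swap true  b c = refl
∧-swap false b c = sym (∧-zeroʳ b)

eqᵇ-sym : ∀ {n} (a b : Fin n) → eqᵇ a b ≡ eqᵇ b a
eqᵇ-sym a b with a ≟ b | b ≟ a
... | yes _   | yes _   = refl
... | no _    | no _    = refl
... | yes a≡b | no b≢a  = contradiction (sym a≡b) b≢a
... | no a≢b  | yes b≡a = contradiction (sym b≡a) a≢b

ind : Bool → ℕ
ind b = if b then 1 else 0

sumBelow : ℕ → (ℕ → ℕ) → ℕ
sumBelow zero    f = 0
sumBelow (suc m) f = sumBelow m f + f m

cntT-as-sum : ∀ m p → cntT m p ≡ sumBelow m (λ t → ind (p t))
cntT-as-sum zero    p = refl
cntT-as-sum (suc m) p = cong (_+ ind (p m)) (cntT-as-sum m p)

sumBelow-zero : ∀ m → sumBelow m (λ _ → 0) ≡ 0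
sumBelow-zero zero    = refl
sumBelow-zero (suc m) = trans (+-identityʳ _) (sumBelow-zero m)

sumBelow-+ : ∀ m f g → sumBelow m (λ t → f t + g t) ≡ sumBelow m f + sumBelow m g
sumBelow-+ zero    f g = refl
sumBelow-+ (suc m) f g =
  trans (cong (_+ (f m + g m)) (sumBelow-+ m f g))
        (interchange (sumBelow m f) (sumBelow m g) (f m) (g m))

sumBelow-*ˡ : ∀ c m f → sumBelow m (λ t → c * f t) ≡ c * sumBelow m f
sumBelow-*ˡ c zero    f = sym (*-zeroʳ c)
sumBelow-*ˡ c (suc m) f =
  trans (cong (_+ c * f m) (sumBelow-*ˡ c m f)) (sym (*-distribˡ-+ c (sumBelow m f) (f m)))

sumBelow-swap : ∀ a b (g : ℕ → ℕ → ℕ) →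
  sumBelow a (λ i → sumBelow b (g i)) ≡ sumBelow b (λ k → sumBelow a (λ i → g i k))
sumBelow-swap zero    b g = sym (sumBelow-zero b)
sumBelow-swap (suc a) b g =
  trans (cong (_+ sumBelow b (g a)) (sumBelow-swap a b g))
        (sym (sumBelow-+ b (λ k → sumBelow a (λ i → g i k)) (g a)))

sumBelow-mono : ∀ m {f g : ℕ → ℕ} → (∀ t → t < m → f t ≤ g t) → sumBelow m f ≤ sumBelow m g
sumBelow-mono zero    f≤g = z≤n
sumBelow-mono (suc m) f≤g =
  +-mono-≤ (sumBelow-mono m (λ t t<m → f≤g t (m<n⇒m<1+n t<m))) (f≤g m ≤-refl)

cntT-weighted : ∀ m p δ (w : ℕ → ℕ) → (∀ t → t < m → p t ≡ true → δ ≤ w t) →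
  cntT m p * δ ≤ sumBelow m w
cntT-weighted m p δ w heavy = begin
  cntT m p * δ                        ≡⟨ *-comm (cntT m p) δ ⟩
  δ * cntT m p                        ≡⟨ cong (δ *_) (cntT-as-sum m p) ⟩
  δ * sumBelow m (λ t → ind (p t))    ≡⟨ sym (sumBelow-*ˡ δ m _) ⟩
  sumBelow m (λ t → δ * ind (p t))    ≤⟨ sumBelow-mono m pointwise ⟩
  sumBelow m w                        ∎
  where
  open ≤-Reasoning
  pointwise : ∀ t → t < m → δ * ind (p t) ≤ w t
  pointwise t t<m with p t in pt
  ... | true  = subst (_≤ w t) (sym (*-identityʳ δ)) (heavy t t<m pt)
  ... | false = subst (_≤ w t) (sym (*-zeroʳ δ)) z≤n

cntT-none : ∀ k p → (∀ t → t < k → p t ≡ false) → cntT k p ≡ 0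
cntT-none zero    p none = refl
cntT-none (suc k) p none rewrite none k ≤-refl =
  trans (+-identityʳ _) (cntT-none k p (λ t t<k → none t (m<n⇒m<1+n t<k)))

cntT-zero⇒false : ∀ k p → cntT k p ≡ 0 → ∀ t → t < k → p t ≡ false
cntT-zero⇒false (suc k) p c≡0 t t<1+k with m≤n⇒m<n∨m≡n (≤-pred t<1+k)
... | inj₁ t<k = cntT-zero⇒false k p (m+n≡0⇒m≡0 (cntT k p) c≡0) t t<k
... | inj₂ refl with p t | m+n≡0⇒n≡0 (cntT k p) c≡0
...   | false | _ = refl

cntT-atMostOne : ∀ m p → (∀ i j → p i ≡ true → p j ≡ true → i ≡ j) → cntT m p ≤ 1
cntT-atMostOne zero    p uniq = z≤n
cntT-atMostOne (suc m) p uniq with p m in pm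
... | false = subst (_≤ 1) (sym (+-identityʳ _)) (cntT-atMostOne m p uniq)
... | true  = ≤-reflexive (cong (_+ 1) (cntT-none m p earlier-false))
  where
  earlier-false : ∀ t → t < m → p t ≡ false
  earlier-false t t<m with p t in pt
  ... | false = refl
  ... | true  = contradiction (uniq t m pt pm) (λ { refl → <-irrefl refl t<m })

cntT-≤-ind : ∀ m p q → (∀ i j → p i ≡ true → p j ≡ true → i ≡ j) →
  (∀ i → p i ≡ true → q ≡ true) → cntT m p ≤ ind q
cntT-≤-ind m p true  uniq _    = cntT-atMostOne m p uniq
cntT-≤-ind m p false _    only = ≤-reflexive (cntT-none m p never)
  where
  never : ∀ t → t < m → p t ≡ false
  never t _ with p t in pt
  ... | false = refl
  ... | true  = contradiction (only t pt) (λ ())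

incidence-split : ∀ {n} (P : Fin n → Bool) (a b x : Fin n) →
  ind ((eqᵇ a x ∨ eqᵇ b x) ∧ P x) ≤ ind (eqᵇ x a ∧ P a) + ind (eqᵇ x b ∧ P b)
incidence-split P a b x with a ≟ x | x ≟ a
... | yes refl | yes _    = m≤m+n _ _
... | yes refl | no a≢a   = contradiction refl a≢a
... | no a≢x   | yes x≡a  = contradiction (sym x≡a) a≢x
... | no _     | no _     with b ≟ x | x ≟ b
...   | yes refl | yes _    = ≤-refl
...   | yes refl | no b≢b   = contradiction refl b≢b
...   | no b≢x   | yes x≡b  = contradiction (sym x≡b) b≢x
...   | no _     | no _     = z≤n

ind-∨ : ∀ a b → ind a + ind b ≤ 2 * ind (a ∨ b)
ind-∨ true  true  = ≤-refl
ind-∨ true  false = m≤m+n 1 1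
ind-∨ false true  = m≤m+n 1 1
ind-∨ false false = z≤n

module EpochLevels {n Δ m : ℕ} (R : Run n Δ m) where

  step-keeps-level : ∀ {s s' : State n Δ} {l} (v : Fin n) → Step s l s' →
    isRecOf R v l ≡ false → lvl s' v ≡ lvl s v
  step-keeps-level v (insNoConflict _ _ _ _)   _ = refl
  step-keeps-level v (insConflict _ _ _ _ _)   _ = refl
  step-keeps-level v (delete _ _)              _ = refl
  step-keeps-level v (detColor {x = x} _ _ _)    notRec rewrite eqᵇ-sym v x | notRec = refl
  step-keeps-level v (randBlank {x = x} _ _ _ _)  notRec rewrite eqᵇ-sym v x | notRec = refl
  step-keeps-level v (randUnique {x = x} _ _ _ _) notRec rewrite eqᵇ-sym v x | notRec = refl

  noRecBetween-spec : ∀ v i k → noRecBetween R v i k ≡ true →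
    ∀ t → i < t → t < k → isRecOf R v (lab R t) ≡ false
  noRecBetween-spec v i k noRec t i<t t<k =
    subst (λ b → b ∧ isRecOf R v (lab R t) ≡ false) (T⇒≡true (<⇒<ᵇ i<t))
      (cntT-zero⇒false k (λ t → (i <ᵇ t) ∧ isRecOf R v (lab R t))
        (≡ᵇ⇒≡ _ 0 (≡true⇒T noRec)) t t<k)

  level-frozen : ∀ v i k → k ≤ m → (∀ t → i < t → t < k → isRecOf R v (lab R t) ≡ false) →
    i < k → lvl (st R k) v ≡ lvl (st R (suc i)) v
  level-frozen v i (suc k) k<m noRec i<1+k with m≤n⇒m<n∨m≡n (≤-pred i<1+k)
  ... | inj₂ refl = refl
  ... | inj₁ i<k  =
    trans (step-keeps-level v (steps R k k<m) (noRec k i<k ≤-refl))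
          (level-frozen v i k (<⇒≤ k<m) (λ t i<t t<k → noRec t i<t (m<n⇒m<1+n t<k)) i<k)

module Incidences {n Δ m : ℕ} (R : Run n Δ m) (ℓ : ℕ) where
  open EpochLevels R

  -- a recolor(v) at time i would open a level-ℓ epoch of v still running at time k
  openAt : Fin n → ℕ → ℕ → Bool
  openAt v k i = (lvl (st R (suc i)) v ≡ᵇ ℓ) ∧ (i <ᵇ k) ∧ noRecBetween R v i k

  liveAt : Fin n → ℕ → ℕ → Bool
  liveAt v k i = isRecOf R v (lab R i) ∧ openAt v k i

  -- 1 if (i , k) is an incidence, where lk is the update at time k
  charge : Label n → ℕ → ℕ → Label n → ℕ
  charge (rec x)   i k lk = ind (isInsOf R x lk ∧ openAt x k i)
  charge (ins _ _) i k lk = 0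
  charge (del _ _) i k lk = 0

  long-epoch-charged : ∀ δ l i → epochOK R ℓ δ l i ≡ true →
    δ ≤ sumBelow m (λ k → charge l i k (lab R k))
  long-epoch-charged δ (rec x) i ok with lvl (st R (suc i)) x ≡ᵇ ℓ
  ... | true = begin
    δ                ≤⟨ ≤ᵇ⇒≤ δ (dur R x i) (≡true⇒T ok) ⟩
    dur R x i        ≡⟨ cntT-as-sum m _ ⟩
    sumBelow m (λ k → ind ((i <ᵇ k) ∧ isInsOf R x (lab R k) ∧ noRecBetween R x i k))
      ≤⟨ sumBelow-mono m (λ k _ → ≤-reflexive (reorder k)) ⟩
    sumBelow m (λ k → ind (isInsOf R x (lab R k) ∧ (i <ᵇ k) ∧ noRecBetween R x i k)) ∎
    where
    open ≤-Reasoning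
    reorder : ∀ k → ind ((i <ᵇ k) ∧ isInsOf R x (lab R k) ∧ noRecBetween R x i k)
                  ≡ ind (isInsOf R x (lab R k) ∧ (i <ᵇ k) ∧ noRecBetween R x i k)
    reorder k = cong ind (∧-swap (i <ᵇ k) (isInsOf R x (lab R k)) (noRecBetween R x i k))

  live-parts : ∀ v k i → liveAt v k i ≡ true →
    isRecOf R v (lab R i) ≡ true × lvl (st R (suc i)) v ≡ ℓ × i < k × noRecBetween R v i k ≡ true
  live-parts v k i live
    with isRecOf R v (lab R i) | lvl (st R (suc i)) v ≡ᵇ ℓ in atℓ | i <ᵇ k in i<k
       | noRecBetween R v i k
  ... | true  | true  | true  | true  = refl , ≡ᵇ⇒≡ _ ℓ (≡true⇒T atℓ) , <ᵇ⇒< i k (≡true⇒T i<k) , refl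
  ... | false | _     | _     | _     with () ← live
  ... | true  | false | _     | _     with () ← live
  ... | true  | true  | false | _     with () ← live
  ... | true  | true  | true  | false with () ← live

  live-level : ∀ v k i → k ≤ m → liveAt v k i ≡ true → lvl (st R k) v ≡ ℓ
  live-level v k i k≤m live with live-parts v k i live
  ... | _ , atℓ , i<k , noRec = trans (level-frozen v i k k≤m (noRecBetween-spec v i k noRec) i<k) atℓ

  live-not-before : ∀ v k i j → liveAt v k i ≡ true → liveAt v k j ≡ true → ¬ (i < j)
  live-not-before v k i j live-i live-j i<j with live-parts v k i live-i | live-parts v k j live-j
  ... | _ , _ , _ , noRec | rec-j , _ , j<k , _ =
    contradiction (trans (sym rec-j) (noRecBetween-spec v i k noRec j i<j j<k)) (λ ())

  live-count : ∀ v k → k ≤ m → cntT m (liveAt v k) ≤ ind (lvl (st R k) v ≡ᵇ ℓ)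
  live-count v k k≤m = cntT-≤-ind m (liveAt v k) _ unique atℓ
    where
    unique : ∀ i j → liveAt v k i ≡ true → liveAt v k j ≡ true → i ≡ j
    unique i j li lj with <-cmp i j
    ... | tri< i<j _ _ = contradiction i<j (live-not-before v k i j li lj)
    ... | tri≈ _ i≡j _ = i≡j
    ... | tri> _ _ j<i = contradiction j<i (live-not-before v k j i lj li)
    atℓ : ∀ i → liveAt v k i ≡ true → (lvl (st R k) v ≡ᵇ ℓ) ≡ true
    atℓ i li = T⇒≡true (≡⇒≡ᵇ _ ℓ (live-level v k i k≤m li))

  uncharged : ∀ lk → (∀ x → isInsOf R x lk ≡ false) → ∀ l i k → charge l i k lk ≡ 0
  uncharged lk notIns (rec x)   i k rewrite notIns x = refl
  uncharged lk notIns (ins _ _) i k = refl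
  uncharged lk notIns (del _ _) i k = refl

  update-charged : ∀ k → k ≤ m → ∀ lk →
    sumBelow m (λ i → charge (lab R i) i k lk) ≤ 2 * ind (insAtLevel R ℓ lk k)
  update-charged k k≤m (ins a b) = begin
    sumBelow m (λ i → charge (lab R i) i k (ins a b))
      ≤⟨ sumBelow-mono m (λ i _ → per-epoch (lab R i) i) ⟩
    sumBelow m (λ i → ind (liveAt a k i) + ind (liveAt b k i))
      ≡⟨ sumBelow-+ m _ _ ⟩
    sumBelow m (λ i → ind (liveAt a k i)) + sumBelow m (λ i → ind (liveAt b k i))
      ≡⟨ sym (cong₂ _+_ (cntT-as-sum m (liveAt a k)) (cntT-as-sum m (liveAt b k))) ⟩
    cntT m (liveAt a k) + cntT m (liveAt b k)
      ≤⟨ +-mono-≤ (live-count a k k≤m) (live-count b k k≤m) ⟩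
    ind (lvl (st R k) a ≡ᵇ ℓ) + ind (lvl (st R k) b ≡ᵇ ℓ)
      ≤⟨ ind-∨ (lvl (st R k) a ≡ᵇ ℓ) (lvl (st R k) b ≡ᵇ ℓ) ⟩
    2 * ind (insAtLevel R ℓ (ins a b) k) ∎
    where
    open ≤-Reasoning
    per-epoch : ∀ l i → charge l i k (ins a b) ≤ ind (isRecOf R a l ∧ openAt a k i)
                                                + ind (isRecOf R b l ∧ openAt b k i)
    per-epoch (rec x)   i = incidence-split (λ v → openAt v k i) a b x
    per-epoch (ins _ _) i = z≤n
    per-epoch (del _ _) i = z≤n
  update-charged k _ (del a b) = ≤-trans
    (sumBelow-mono m (λ i _ → ≤-reflexive (uncharged (del a b) (λ _ → refl) (lab R i) i k)))
    (≤-reflexive (sumBelow-zero m))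
  update-charged k _ (rec y) = ≤-trans
    (sumBelow-mono m (λ i _ → ≤-reflexive (uncharged (rec y) (λ _ → refl) (lab R i) i k)))
    (≤-reflexive (sumBelow-zero m))

lemma11 : ∀ {n Δ m : ℕ} → 0 < Δ → (R : Run n Δ m) → (ℓ δ : ℕ) → 0 < δ →
          numLongEpochs R ℓ δ * δ ≤ 2 * numIN R ℓ
lemma11 {m = m} _ R ℓ δ _ = begin
  numLongEpochs R ℓ δ * δ
    ≤⟨ cntT-weighted m _ δ _ (λ i _ → long-epoch-charged δ (lab R i) i) ⟩
  sumBelow m (λ i → sumBelow m (λ k → incidence i k))
    ≡⟨ sumBelow-swap m m incidence ⟩
  sumBelow m (λ k → sumBelow m (λ i → incidence i k))
    ≤⟨ sumBelow-mono m (λ k k<m → update-charged k (<⇒≤ k<m) (lab R k)) ⟩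
  sumBelow m (λ k → 2 * ind (insAtLevel R ℓ (lab R k) k))
    ≡⟨ sumBelow-*ˡ 2 m _ ⟩
  2 * sumBelow m (λ k → ind (insAtLevel R ℓ (lab R k) k))
    ≡⟨ cong (2 *_) (sym (cntT-as-sum m _)) ⟩
  2 * numIN R ℓ ∎
  where
  open ≤-Reasoning
  open Incidences R ℓ
  incidence : ℕ → ℕ → ℕ
  incidence i k = charge (lab R i) i k (lab R k)
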